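{- Let $(G,\le_G)$ be an ordered group and let $\rhd_{\mathrm s}$ be the relation defined by $A\rhd_{\mathrm s}b$ iff $a\le_G b$ for some $a\in A$ (the finest system of ideals for $G$). Then the regularisation $\vdash_{\rhd_{\mathrm s}}$ of $\rhd_{\mathrm s}$ is the finest regular entailment relation for $G$.
   Context: Groups are commutative; an ordered group has a partial order compatible with addition. $\mathrm{P}_{\mathrm{fe}}^*(G)$ is the set of nonempty finite subsets of $G$; $A-B=\{a-b\}$, $x+A=\{x+a\}$. A system of ideals for $G$ is a relation $\rhd$ between $\mathrm{P}_{\mathrm{fe}}^*(G)$ and $G$ with $a\rhd a$; $A\rhd b\Rightarrow A\cup A'\rhd b$; ($A\rhd c$ and $A\cup\{c\}\rhd b$) $\Rightarrow A\rhd b$; $a\le_G b\Rightarrow a\rhd b$; $A\rhd b\Rightarrow x+A\rhd x+b$. For $y_i\in G$, $\rhd_{y_1,\dots,y_n}$ is the finest system of ideals containing $\rhd$ with $0\rhd_{y_1,\dots,y_n}y_i$ for all $i$. Regularisation: $A\vdash_\rhd B$ iff there exist $x_1,\dots,x_m\in G$ with $A-B\rhd_{\pm x_1,\dots,\pm x_m}0$ for every choice of signs. An unbounded entailment relation is a relation $\vdash$ on $\mathrm{P}_{\mathrm{fe}}^*(G)$ with $a\vdash a$; $A\vdash B\Rightarrow A\cup A'\vdash B\cup B'$; ($A\vdash B\cup\{c\}$ and $A\cup\{c\}\vdash B$) $\Rightarrow A\vdash B$; it is regular if moreover $a\le_G b\Rightarrow a\vdash b$, $A\vdash B\Rightarrow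 x+A\vdash x+B$, and $x+a,y+b\vdash y+a,x+b$. "Finer" means: $\vdash_1$ is finer than $\vdash_2$ if $A\vdash_1B$ implies $A\vdash_2B$. -}

module Defs where

open import Level using (Level; _⊔_) renaming (suc to lsuc)
open import Data.Bool using (Bool; true; false)
open import Data.List using (List; []; _∷_)
open import Data.List.NonEmpty as L⁺ using (List⁺; [_]; _∷_; _∷⁺_; toList; concatMap)
open import Data.List.Membership.Propositional using (_∈_)
open import Data.Product using (Σ; _×_; _,_)
open import Relation.Binary.PropositionalEquality using (_≡_)
open import Relation.Binary.Structures using (IsPartialOrder)
open import Algebra.Structures using (IsAbelianGroup)

record OrderedGroup : Set₁ where
  infixl 6 _+_
  infix 4 _≤_
  field
    Carrier        : Set
    _+_            : Carrier → Carrier → Carrier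
    0#             : Carrier
    -_             : Carrier → Carrier
    _≤_            : Carrier → Carrier → Set
    isAbelianGroup : IsAbelianGroup _≡_ _+_ 0# -_
    isPartialOrder : IsPartialOrder _≡_ _≤_
    +-mono-≤       : ∀ {a b} c → a ≤ b → c + a ≤ c + b

module _ (G : OrderedGroup) where
  open OrderedGroup G

  -- Nonempty finite subsets of G are represented by nonempty lists;
  -- all relations below are required to be closed under inclusion of the
  -- underlying sets, so only the set of elements matters.
  Fin⁺ : Set
  Fin⁺ = List⁺ Carrier

  infix 4 _⊆_
  _⊆_ : Fin⁺ → Fin⁺ → Set
  A ⊆ B = ∀ {x} → x ∈ toList A → x ∈ toList B

  _+ˢ_ : Carrier → Fin⁺ → Fin⁺
  x +ˢ A = L⁺.map (x +_) A

  _-ˢ_ : Fin⁺ → Fin⁺ → Fin⁺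
  A -ˢ B = concatMap (λ a → L⁺.map (λ b → a + (- b)) B) A

  _∪_ : Fin⁺ → Fin⁺ → Fin⁺
  A ∪ B = A L⁺.⁺++⁺ B

  _▷ₛ_ : Fin⁺ → Carrier → Set
  A ▷ₛ b = Σ Carrier λ a → a ∈ toList A × a ≤ b

  -- ▷_{y₁,…,yₙ}: the finest system of ideals containing ▷ and with 0 ▷ yᵢ,
  -- i.e. the least relation closed under the axioms (inductive closure).
  -- Closure under set inclusion of the left argument is included so that
  -- the relation depends on the underlying set only.
  data Gen {ℓ} (_▷_ : Fin⁺ → Carrier → Set ℓ) (ys : List Carrier)
           : Fin⁺ → Carrier → Set ℓ where
    base  : ∀ {A b} → A ▷ b → Gen _▷_ ys A b
    gen   : ∀ {y} → y ∈ ys → Gen _▷_ ys [ 0# ] y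
    refl′ : ∀ a → Gen _▷_ ys [ a ] a
    weak  : ∀ {A A' b} → Gen _▷_ ys A b → A ⊆ A' → Gen _▷_ ys A' b
    cut   : ∀ {A b c} → Gen _▷_ ys A c → Gen _▷_ ys (A ∪ [ c ]) b → Gen _▷_ ys A b
    ord   : ∀ {a b} → a ≤ b → Gen _▷_ ys [ a ] b
    trans : ∀ {A b} x → Gen _▷_ ys A b → Gen _▷_ ys (x +ˢ A) (x + b)

  data Signs : List Carrier → List Carrier → Set where
    []  : Signs [] []
    pos : ∀ {x xs zs} → Signs xs zs → Signs (x ∷ xs) (x ∷ zs)
    neg : ∀ {x xs zs} → Signs xs zs → Signs (x ∷ xs) ((- x) ∷ zs)

  Reg : ∀ {ℓ} → (Fin⁺ → Carrier → Set ℓ) → Fin⁺ → Fin⁺ → Set ℓ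
  Reg _▷_ A B = Σ (List Carrier) λ xs →
    ∀ zs → Signs xs zs → Gen _▷_ zs (A -ˢ B) 0#

  record IsUnboundedEntailment {ℓ} (_⊢_ : Fin⁺ → Fin⁺ → Set ℓ) : Set ℓ where
    field
      refl⊢ : ∀ a → [ a ] ⊢ [ a ]
      -- A ⊢ B ⇒ A ∪ A' ⊢ B ∪ B', phrased via set inclusion (this also makes
      -- ⊢ depend only on the underlying finite sets)
      weak⊢ : ∀ {A A' B B'} → A ⊢ B → A ⊆ A' → B ⊆ B' → A' ⊢ B'
      cut⊢  : ∀ {A B c} → A ⊢ (B ∪ [ c ]) → (A ∪ [ c ]) ⊢ B → A ⊢ B

  record IsRegularEntailment {ℓ} (_⊢_ : Fin⁺ → Fin⁺ → Set ℓ) : Set ℓ where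
    field
      isUnboundedEntailment : IsUnboundedEntailment _⊢_
      ord⊢   : ∀ {a b} → a ≤ b → [ a ] ⊢ [ b ]
      trans⊢ : ∀ {A B} x → A ⊢ B → (x +ˢ A) ⊢ (x +ˢ B)
      swap⊢  : ∀ x y a b → ((x + a) ∷ y + b ∷ []) ⊢ ((y + a) ∷ x + b ∷ [])

  IsFinestRegular : (Fin⁺ → Fin⁺ → Set) → Set₁
  IsFinestRegular _⊢_ =
    IsRegularEntailment _⊢_ ×
    (∀ (_⊢'_ : Fin⁺ → Fin⁺ → Set) → IsRegularEntailment _⊢'_ →
       ∀ {A B} → A ⊢ B → A ⊢' B)

-- Write ⟨zs⟩ for the submonoid generated by zs. The system of ideals (▷ₛ)_zs relates C and b exactly
-- when c + m ≤ b for some c ∈ C and m ∈ ⟨zs⟩, so A ⊢ B holds for the regularisation iff there are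
-- x₁, …, xₙ such that for every choice of signs a + m ≤ b for some a ∈ A, b ∈ B, m ∈ ⟨±x₁, …, ±xₙ⟩.
-- This explicit relation is a regular entailment relation; a cut is witnessed by concatenating the two
-- lists of xᵢ. Conversely, in any regular entailment relation ⊢ such a witness gives A ⊢ {b - m} for
-- each choice of signs, and the signs are removed one at a time: iterating x + a, y + b ⊢ y + a, x + b
-- yields u, v ⊢ u + k·h, v - l·h, so cutting the sets obtained for +h against those for -h leaves
-- sums over one generator fewer; with none left, A ⊢ B.

module Submission where

open import Defs hiding (Fin⁺; _⊆_; _+ˢ_; _-ˢ_; _∪_)
open import Function using (_∘_)
open import Data.List using (List; []; _∷_; _++_; cartesianProductWith)
import Data.List as List
open import Data.List.Properties using (++-assoc; ++-identityʳ)
open import Data.List.NonEmpty as L⁺ using (List⁺; [_]; _∷_; _⁺++_; _⁺++⁺_; toList)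
open import Data.List.Membership.Propositional using (_∈_)
open import Data.List.Membership.Propositional.Properties
  using (∈-++⁺ˡ; ∈-++⁺ʳ; ∈-++⁻; ∈-map⁺; ∈-map⁻; ∈-cartesianProductWith⁺; ∈-cartesianProductWith⁻)
open import Data.List.Relation.Unary.Any using (here; there)
open import Data.List.Relation.Binary.Subset.Propositional using () renaming (_⊆_ to _⊆ˡ_)
open import Data.List.Relation.Binary.Subset.Propositional.Properties
  using (⊆-refl; ⊆-reflexive; ⊆-reflexive-↭; xs⊆xs++ys; xs⊆ys++xs)
open import Data.List.Relation.Binary.Permutation.Propositional using (↭-trans)
open import Data.List.Relation.Binary.Permutation.Propositional.Properties using (shift; ++-comm)
open import Data.Product using (Σ-syntax; proj₁; ∃-syntax; ∃₂; _×_; _,_)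
open import Data.Sum using (inj₁; inj₂)
open import Relation.Binary.PropositionalEquality
  using (_≡_; refl; sym; cong; cong₂; subst; subst₂; module ≡-Reasoning)
  renaming (trans to ≡-trans)
open import Relation.Binary.Structures using (IsPartialOrder)
open import Algebra.Structures using (IsAbelianGroup)
open import Algebra.Bundles using (AbelianGroup)
open import Level using (0ℓ)

module Regularisation (G : OrderedGroup) where
  open OrderedGroup G
  open IsAbelianGroup isAbelianGroup using (_-_; assoc; comm; identityˡ; identityʳ; inverseʳ)
  open IsPartialOrder isPartialOrder
    using () renaming (refl to ≤-refl; reflexive to ≤-reflexive; trans to ≤-trans)

  abelianGroup : AbelianGroup 0ℓ 0ℓ
  abelianGroup = record
    { Carrier = Carrier ; _≈_ = _≡_ ; _∙_ = _+_ ; ε = 0# ; _⁻¹ = -_ ; isAbelianGroup = isAbelianGroup }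

  open import Algebra.Properties.AbelianGroup abelianGroup
    using (ε⁻¹≈ε; ⁻¹-∙-comm; ⁻¹-anti-homo‿-; //-rightDividesˡ; //-rightDividesʳ)

  Fin⁺ : Set
  Fin⁺ = Defs.Fin⁺ G

  _⊆_ : Fin⁺ → Fin⁺ → Set
  _⊆_ = Defs._⊆_ G

  _+ˢ_ : Carrier → Fin⁺ → Fin⁺
  _+ˢ_ = Defs._+ˢ_ G

  _-ˢ_ : Fin⁺ → Fin⁺ → Fin⁺
  _-ˢ_ = Defs._-ˢ_ G

  _∪_ : Fin⁺ → Fin⁺ → Fin⁺
  _∪_ = Defs._∪_ G

  open ≡-Reasoning

  x+[y-x]≡y : ∀ x y → x + (y - x) ≡ y
  x+[y-x]≡y x y = ≡-trans (comm x (y - x)) (//-rightDividesˡ x y)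

  [y+b]+[x-y]≡x+b : ∀ x y b → (y + b) + (x - y) ≡ x + b
  [y+b]+[x-y]≡x+b x y b = begin
    (y + b) + (x - y)   ≡⟨ cong (_+ (x - y)) (comm y b) ⟩
    (b + y) + (x - y)   ≡⟨ assoc b y (x - y) ⟩
    b + (y + (x - y))   ≡⟨ cong (b +_) (x+[y-x]≡y y x) ⟩
    b + x               ≡⟨ comm b x ⟩
    x + b               ∎

  [x-y]+z≡[x+z]-y : ∀ x y z → (x - y) + z ≡ (x + z) - y
  [x-y]+z≡[x+z]-y x y z = begin
    (x + - y) + z   ≡⟨ assoc x (- y) z ⟩
    x + (- y + z)   ≡⟨ cong (x +_) (comm (- y) z) ⟩
    x + (z + - y)   ≡⟨ assoc x z (- y) ⟨
    (x + z) + - y   ∎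

  [x-[y+z]]+z≡x-y : ∀ x y z → (x - (y + z)) + z ≡ x - y
  [x-[y+z]]+z≡x-y x y z = begin
    (x + - (y + z)) + z   ≡⟨ cong (λ w → (x + w) + z) (⁻¹-∙-comm y z) ⟨
    (x + (- y + - z)) + z ≡⟨ assoc x (- y + - z) z ⟩
    x + ((- y + - z) + z) ≡⟨ cong (x +_) (//-rightDividesˡ z (- y)) ⟩
    x - y                 ∎

  x-0≡x : ∀ x → x - 0# ≡ x
  x-0≡x x = ≡-trans (cong (x +_) ε⁻¹≈ε) (identityʳ x)

  +-monoˡ-≤ : ∀ {x y} z → x ≤ y → x + z ≤ y + z
  +-monoˡ-≤ {x} {y} z x≤y = subst₂ _≤_ (comm z x) (comm z y) (+-mono-≤ z x≤y)

  x+y≤z⇒x≤z-y : ∀ {x y z} → x + y ≤ z → x ≤ z - y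
  x+y≤z⇒x≤z-y {x} {y} x+y≤z = subst (_≤ _) (//-rightDividesʳ y x) (+-monoˡ-≤ (- y) x+y≤z)

  [x-y]+z≤0⇒x+z≤y : ∀ {x y z} → (x - y) + z ≤ 0# → x + z ≤ y
  [x-y]+z≤0⇒x+z≤y {x} {y} {z} le = subst₂ _≤_ lhs (identityˡ y) (+-monoˡ-≤ y le)
    where
      lhs : ((x - y) + z) + y ≡ x + z
      lhs = ≡-trans (cong (_+ y) ([x-y]+z≡[x+z]-y x y z)) (//-rightDividesˡ y (x + z))

  x+z≤y⇒[x-y]+z≤0 : ∀ {x y z} → x + z ≤ y → (x - y) + z ≤ 0#
  x+z≤y⇒[x-y]+z≤0 {x} {y} {z} le =
    subst₂ _≤_ (sym ([x-y]+z≡[x+z]-y x y z)) (inverseʳ y) (+-monoˡ-≤ (- y) le)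

  x+m≤y⇒y+n≤z⇒x+[m+n]≤z : ∀ {x y z m n} → x + m ≤ y → y + n ≤ z → x + (m + n) ≤ z
  x+m≤y⇒y+n≤z⇒x+[m+n]≤z {x} {y} {m = m} {n} le₁ le₂ =
    ≤-trans (subst (_≤ y + n) (assoc x m n) (+-monoˡ-≤ n le₁)) le₂

  x≤y⇒x+0≤y : ∀ {x y} → x ≤ y → x + 0# ≤ y
  x≤y⇒x+0≤y {x} = subst (_≤ _) (sym (identityʳ x))

  data IsSumOf (zs : List Carrier) : Carrier → Set where
    []  : IsSumOf zs 0#
    _∷_ : ∀ {z m} → z ∈ zs → IsSumOf zs m → IsSumOf zs (z + m)

  IsSumOf-∈ : ∀ {zs z} → z ∈ zs → IsSumOf zs z
  IsSumOf-∈ {z = z} z∈zs = subst (IsSumOf _) (identityʳ z) (z∈zs ∷ [])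

  IsSumOf-+ : ∀ {zs m n} → IsSumOf zs m → IsSumOf zs n → IsSumOf zs (m + n)
  IsSumOf-+ {n = n} [] N = subst (IsSumOf _) (sym (identityˡ n)) N
  IsSumOf-+ {n = n} (_∷_ {z} {m} z∈zs M) N = subst (IsSumOf _) (sym (assoc z m n)) (z∈zs ∷ IsSumOf-+ M N)

  IsSumOf-mono : ∀ {zs zs′ m} → (∀ {z} → z ∈ zs → z ∈ zs′) → IsSumOf zs m → IsSumOf zs′ m
  IsSumOf-mono zs⊆zs′ []           = []
  IsSumOf-mono zs⊆zs′ (z∈zs ∷ M) = zs⊆zs′ z∈zs ∷ IsSumOf-mono zs⊆zs′ M

  IsSumOf-++⁻ : ∀ ws {xs m} → IsSumOf (ws ++ xs) m →
                ∃₂ λ m₁ m₂ → IsSumOf ws m₁ × IsSumOf xs m₂ × m ≡ m₁ + m₂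
  IsSumOf-++⁻ ws [] = 0# , 0# , [] , [] , sym (identityʳ 0#)
  IsSumOf-++⁻ ws (_∷_ {z} {m} z∈ M) with IsSumOf-++⁻ ws M | ∈-++⁻ ws z∈
  ... | m₁ , m₂ , M₁ , M₂ , refl | inj₁ z∈ws = z + m₁ , m₂ , z∈ws ∷ M₁ , M₂ , sym (assoc z m₁ m₂)
  ... | m₁ , m₂ , M₁ , M₂ , refl | inj₂ z∈xs = m₁ , z + m₂ , M₁ , z∈xs ∷ M₂ , z+[m₁+m₂]≡m₁+[z+m₂]
    where
      z+[m₁+m₂]≡m₁+[z+m₂] : z + (m₁ + m₂) ≡ m₁ + (z + m₂)
      z+[m₁+m₂]≡m₁+[z+m₂] = begin
        z + (m₁ + m₂)   ≡⟨ assoc z m₁ m₂ ⟨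
        (z + m₁) + m₂   ≡⟨ cong (_+ m₂) (comm z m₁) ⟩
        (m₁ + z) + m₂   ≡⟨ assoc m₁ z m₂ ⟩
        m₁ + (z + m₂)   ∎

  infix 4 _▷ₛ[_]_
  _▷ₛ[_]_ : Fin⁺ → List Carrier → Carrier → Set
  C ▷ₛ[ zs ] b = ∃[ c ] c ∈ toList C × ∃[ m ] IsSumOf zs m × c + m ≤ b

  ∈∧≤⇒▷ₛ[] : ∀ {C zs c b} → c ∈ toList C → c ≤ b → C ▷ₛ[ zs ] b
  ∈∧≤⇒▷ₛ[] {c = c} c∈C c≤b = c , c∈C , 0# , [] , x≤y⇒x+0≤y c≤b

  Gen⇒▷ₛ[] : ∀ {zs C b} → Gen G (_▷ₛ_ G) zs C b → C ▷ₛ[ zs ] b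
  Gen⇒▷ₛ[] (base (a , a∈A , a≤b)) = ∈∧≤⇒▷ₛ[] a∈A a≤b
  Gen⇒▷ₛ[] (gen {y} y∈zs)         = 0# , here refl , y , IsSumOf-∈ y∈zs , ≤-reflexive (identityˡ y)
  Gen⇒▷ₛ[] (refl′ a)              = ∈∧≤⇒▷ₛ[] (here refl) ≤-refl
  Gen⇒▷ₛ[] (ord a≤b)              = ∈∧≤⇒▷ₛ[] (here refl) a≤b
  Gen⇒▷ₛ[] (weak A▷b A⊆A′) with Gen⇒▷ₛ[] A▷b
  ... | c , c∈A , rest = c , A⊆A′ c∈A , rest
  Gen⇒▷ₛ[] (cut {A} A▷c A∪c▷b) with Gen⇒▷ₛ[] A▷c | Gen⇒▷ₛ[] A∪c▷b
  ... | d , d∈A , m , M , d+m≤c | e , e∈A∪c , n , N , e+n≤b with ∈-++⁻ (toList A) e∈A∪c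
  ...   | inj₁ e∈A        = e , e∈A , n , N , e+n≤b
  ...   | inj₂ (here refl) = d , d∈A , m + n , IsSumOf-+ M N , x+m≤y⇒y+n≤z⇒x+[m+n]≤z d+m≤c e+n≤b
  Gen⇒▷ₛ[] (trans {b = b} x A▷b) with Gen⇒▷ₛ[] A▷b
  ... | c , c∈A , m , M , c+m≤b =
    x + c , ∈-map⁺ (x +_) c∈A , m , M , subst (_≤ x + b) (sym (assoc x c m)) (+-mono-≤ x c+m≤b)

  IsSumOf⇒Gen : ∀ {zs m} → IsSumOf zs m → Gen G (_▷ₛ_ G) zs [ 0# ] m
  IsSumOf⇒Gen []                     = refl′ 0#
  IsSumOf⇒Gen (_∷_ {z} z∈zs M) =
    cut (gen z∈zs) (weak (trans z (IsSumOf⇒Gen M)) λ { (here refl) → there (here (identityʳ z)) })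

  ▷ₛ[]⇒Gen : ∀ {zs C b} → C ▷ₛ[ zs ] b → Gen G (_▷ₛ_ G) zs C b
  ▷ₛ[]⇒Gen {C = C} (c , c∈C , m , M , c+m≤b) =
    weak (cut (trans c (IsSumOf⇒Gen M)) (weak (ord c+m≤b) λ { (here refl) → there (here refl) }))
         λ { (here refl) → subst (_∈ toList C) (sym (identityʳ c)) c∈C }

  toList-[-ˢ] : ∀ A B → toList (A -ˢ B) ≡ cartesianProductWith _-_ (toList A) (toList B)
  toList-[-ˢ] (a ∷ as) B = cong (List.map (λ b → a - b) (toList B) ++_) (concat-rows as)
    where
      concat-rows : ∀ as → List.concat (List.map toList (List.map (λ a → L⁺.map (λ b → a - b) B) as))
                           ≡ cartesianProductWith _-_ as (toList B)
      concat-rows []       = refl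
      concat-rows (a ∷ as) = cong (List.map (λ b → a - b) (toList B) ++_) (concat-rows as)

  ∈-[-ˢ]⁺ : ∀ {A B a b} → a ∈ toList A → b ∈ toList B → a - b ∈ toList (A -ˢ B)
  ∈-[-ˢ]⁺ {A} {B} {a} {b} a∈A b∈B =
    subst (a - b ∈_) (sym (toList-[-ˢ] A B)) (∈-cartesianProductWith⁺ _-_ a∈A b∈B)

  ∈-[-ˢ]⁻ : ∀ {A B d} → d ∈ toList (A -ˢ B) → ∃₂ λ a b → a ∈ toList A × b ∈ toList B × d ≡ a - b
  ∈-[-ˢ]⁻ {A} {B} {d} d∈ = ∈-cartesianProductWith⁻ _-_ (toList A) (toList B) (subst (d ∈_) (toList-[-ˢ] A B) d∈)

  infix 4 _⊢ₛ[_]_ _⊢ₛ_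
  _⊢ₛ[_]_ : Fin⁺ → List Carrier → Fin⁺ → Set
  A ⊢ₛ[ zs ] B = ∃₂ λ a b → a ∈ toList A × b ∈ toList B × ∃[ m ] IsSumOf zs m × a + m ≤ b

  _⊢ₛ_ : Fin⁺ → Fin⁺ → Set
  A ⊢ₛ B = ∃[ xs ] ∀ zs → Signs G xs zs → A ⊢ₛ[ zs ] B

  -ˢ▷ₛ[]⇒⊢ₛ[] : ∀ {A B zs} → (A -ˢ B) ▷ₛ[ zs ] 0# → A ⊢ₛ[ zs ] B
  -ˢ▷ₛ[]⇒⊢ₛ[] {A} {B} (d , d∈ , m , M , d+m≤0) with ∈-[-ˢ]⁻ {A} {B} d∈
  ... | a , b , a∈A , b∈B , refl = a , b , a∈A , b∈B , m , M , [x-y]+z≤0⇒x+z≤y d+m≤0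

  ⊢ₛ[]⇒-ˢ▷ₛ[] : ∀ {A B zs} → A ⊢ₛ[ zs ] B → (A -ˢ B) ▷ₛ[ zs ] 0#
  ⊢ₛ[]⇒-ˢ▷ₛ[] {A} {B} (a , b , a∈A , b∈B , m , M , a+m≤b) =
    a - b , ∈-[-ˢ]⁺ {A} {B} a∈A b∈B , m , M , x+z≤y⇒[x-y]+z≤0 a+m≤b

  Reg⇒⊢ₛ : ∀ {A B} → Reg G (_▷ₛ_ G) A B → A ⊢ₛ B
  Reg⇒⊢ₛ (xs , A-B▷0) = xs , λ zs signs → -ˢ▷ₛ[]⇒⊢ₛ[] (Gen⇒▷ₛ[] (A-B▷0 zs signs))

  ⊢ₛ⇒Reg : ∀ {A B} → A ⊢ₛ B → Reg G (_▷ₛ_ G) A B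
  ⊢ₛ⇒Reg (xs , A⊢B) = xs , λ zs signs → ▷ₛ[]⇒Gen (⊢ₛ[]⇒-ˢ▷ₛ[] (A⊢B zs signs))

  ∈∧∈∧≤⇒⊢ₛ[] : ∀ {A B zs a b} → a ∈ toList A → b ∈ toList B → a ≤ b → A ⊢ₛ[ zs ] B
  ∈∧∈∧≤⇒⊢ₛ[] {a = a} {b} a∈A b∈B a≤b = a , b , a∈A , b∈B , 0# , [] , x≤y⇒x+0≤y a≤b

  ⊢ₛ-map : ∀ {A B A′ B′} → (∀ {zs} → A ⊢ₛ[ zs ] B → A′ ⊢ₛ[ zs ] B′) → A ⊢ₛ B → A′ ⊢ₛ B′
  ⊢ₛ-map f (xs , A⊢B) = xs , λ zs signs → f (A⊢B zs signs)

  ⊢ₛ-refl : ∀ a → [ a ] ⊢ₛ [ a ]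
  ⊢ₛ-refl a = [] , λ { _ [] → ∈∧∈∧≤⇒⊢ₛ[] (here refl) (here refl) ≤-refl }

  ⊢ₛ-ord : ∀ {a b} → a ≤ b → [ a ] ⊢ₛ [ b ]
  ⊢ₛ-ord a≤b = [] , λ { _ [] → ∈∧∈∧≤⇒⊢ₛ[] (here refl) (here refl) a≤b }

  ⊢ₛ-weak : ∀ {A A′ B B′} → A ⊢ₛ B → A ⊆ A′ → B ⊆ B′ → A′ ⊢ₛ B′
  ⊢ₛ-weak A⊢B A⊆A′ B⊆B′ =
    ⊢ₛ-map (λ (a , b , a∈A , b∈B , rest) → a , b , A⊆A′ a∈A , B⊆B′ b∈B , rest) A⊢B

  ⊢ₛ-trans : ∀ {A B} x → A ⊢ₛ B → (x +ˢ A) ⊢ₛ (x +ˢ B)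
  ⊢ₛ-trans x = ⊢ₛ-map λ (a , b , a∈A , b∈B , m , M , a+m≤b) →
    x + a , x + b , ∈-map⁺ (x +_) a∈A , ∈-map⁺ (x +_) b∈B , m , M ,
    subst (_≤ x + b) (sym (assoc x a m)) (+-mono-≤ x a+m≤b)

  ⊢ₛ-swap : ∀ x y a b → ((x + a) ∷ y + b ∷ []) ⊢ₛ ((y + a) ∷ x + b ∷ [])
  -- One generator x - y suffices: added to y + b it gives x + b, subtracted from x + a it gives y + a.
  ⊢ₛ-swap x y a b = (x - y) ∷ [] , λ
    { _ (pos []) → y + b , x + b , there (here refl) , there (here refl) ,
                   x - y , IsSumOf-∈ (here refl) , ≤-reflexive ([y+b]+[x-y]≡x+b x y b)
    ; _ (neg []) → x + a , y + a , here refl , here refl ,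
                   - (x - y) , IsSumOf-∈ (here refl) ,
                   ≤-reflexive (≡-trans (cong ((x + a) +_) (⁻¹-anti-homo‿- x y)) ([y+b]+[x-y]≡x+b y x a)) }

  Signs-++⁻ : ∀ xs₁ {xs₂ zs} → Signs G (xs₁ ++ xs₂) zs →
              ∃₂ λ zs₁ zs₂ → Signs G xs₁ zs₁ × Signs G xs₂ zs₂ × zs ≡ zs₁ ++ zs₂
  Signs-++⁻ []        signs = [] , _ , [] , signs , refl
  Signs-++⁻ (x ∷ xs₁) (pos signs) with Signs-++⁻ xs₁ signs
  ... | zs₁ , zs₂ , signs₁ , signs₂ , refl = x ∷ zs₁ , zs₂ , pos signs₁ , signs₂ , refl
  Signs-++⁻ (x ∷ xs₁) (neg signs) with Signs-++⁻ xs₁ signs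
  ... | zs₁ , zs₂ , signs₁ , signs₂ , refl = - x ∷ zs₁ , zs₂ , neg signs₁ , signs₂ , refl

  ⊢ₛ[]-cut : ∀ {A B c} zs₁ zs₂ → A ⊢ₛ[ zs₁ ] (B ∪ [ c ]) → (A ∪ [ c ]) ⊢ₛ[ zs₂ ] B → A ⊢ₛ[ zs₁ ++ zs₂ ] B
  ⊢ₛ[]-cut {A} {B} zs₁ zs₂ (a , b , a∈A , b∈B∪c , m , M , a+m≤b) (a′ , b′ , a′∈A∪c , b′∈B , n , N , a′+n≤b′)
    with ∈-++⁻ (toList B) b∈B∪c | ∈-++⁻ (toList A) a′∈A∪c
  ... | inj₁ b∈B         | _                = a , b , a∈A , b∈B , m , IsSumOf-mono (xs⊆xs++ys zs₁ zs₂) M , a+m≤b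
  ... | inj₂ _           | inj₁ a′∈A        = a′ , b′ , a′∈A , b′∈B , n , IsSumOf-mono (xs⊆ys++xs zs₂ zs₁) N , a′+n≤b′
  ... | inj₂ (here refl) | inj₂ (here refl) =
    a , b′ , a∈A , b′∈B , m + n ,
    IsSumOf-+ (IsSumOf-mono (xs⊆xs++ys zs₁ zs₂) M) (IsSumOf-mono (xs⊆ys++xs zs₂ zs₁) N) ,
    x+m≤y⇒y+n≤z⇒x+[m+n]≤z a+m≤b a′+n≤b′

  ⊢ₛ-cut : ∀ {A B c} → A ⊢ₛ (B ∪ [ c ]) → (A ∪ [ c ]) ⊢ₛ B → A ⊢ₛ B
  ⊢ₛ-cut {A} {B} {c} (xs₁ , A⊢B∪c) (xs₂ , A∪c⊢B) = xs₁ ++ xs₂ , cut-signs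
    where
      cut-signs : ∀ zs → Signs G (xs₁ ++ xs₂) zs → A ⊢ₛ[ zs ] B
      cut-signs zs signs with Signs-++⁻ xs₁ signs
      ... | zs₁ , zs₂ , signs₁ , signs₂ , refl =
        ⊢ₛ[]-cut {A} {B} {c} zs₁ zs₂ (A⊢B∪c zs₁ signs₁) (A∪c⊢B zs₂ signs₂)

  ⊢ₛ-isRegularEntailment : IsRegularEntailment G _⊢ₛ_
  ⊢ₛ-isRegularEntailment = record
    { isUnboundedEntailment = record { refl⊢ = ⊢ₛ-refl ; weak⊢ = ⊢ₛ-weak ; cut⊢ = ⊢ₛ-cut }
    ; ord⊢   = ⊢ₛ-ord
    ; trans⊢ = ⊢ₛ-trans
    ; swap⊢  = ⊢ₛ-swap
    }

  IsRegularEntailment-resp-⇔ : ∀ {_⊢_ _⊢′_ : Fin⁺ → Fin⁺ → Set} →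
    (∀ {A B} → A ⊢ B → A ⊢′ B) → (∀ {A B} → A ⊢′ B → A ⊢ B) →
    IsRegularEntailment G _⊢_ → IsRegularEntailment G _⊢′_
  IsRegularEntailment-resp-⇔ to from isRegular = record
    { isUnboundedEntailment = record
      { refl⊢ = λ a → to (refl⊢ a)
      ; weak⊢ = λ A⊢B A⊆A′ B⊆B′ → to (weak⊢ (from A⊢B) A⊆A′ B⊆B′)
      ; cut⊢  = λ A⊢B∪c A∪c⊢B → to (cut⊢ (from A⊢B∪c) (from A∪c⊢B))
      }
    ; ord⊢   = λ a≤b → to (ord⊢ a≤b)
    ; trans⊢ = λ x A⊢B → to (trans⊢ x (from A⊢B))
    ; swap⊢  = λ x y a b → to (swap⊢ x y a b)
    }
    where
      open IsRegularEntailment isRegular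
      open IsUnboundedEntailment isUnboundedEntailment

  -- The element top - offset of G, kept together with its witnesses so that dropping generators
  -- from the offset acts on a list of them as a function.
  record Lowered (B : Fin⁺) (ws : List Carrier) : Set where
    constructor lowered
    field
      top        : Carrier
      top∈B      : top ∈ toList B
      offset     : Carrier
      offset-sum : IsSumOf ws offset

    value : Carrier
    value = top - offset

  open Lowered using (value)

  restrict : ∀ {B} ws xs (t : Lowered B (ws ++ xs)) →
             Σ[ t′ ∈ Lowered B ws ] ∃[ r ] IsSumOf xs r × value t + r ≡ value t′
  restrict ws _ (lowered b b∈B m M) =
    let m₁ , m₂ , M₁ , M₂ , m≡m₁+m₂ = IsSumOf-++⁻ ws M
    in lowered b b∈B m₁ M₁ , m₂ , M₂ , (begin
         (b - m) + m₂          ≡⟨ cong (λ k → (b - k) + m₂) m≡m₁+m₂ ⟩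
         (b - (m₁ + m₂)) + m₂  ≡⟨ [x-[y+z]]+z≡x-y b m₁ m₂ ⟩
         b - m₁                ∎)

  module _ {_⊢_ : Fin⁺ → Fin⁺ → Set} (isRegular : IsRegularEntailment G _⊢_) where
    open IsRegularEntailment isRegular
    open IsUnboundedEntailment isUnboundedEntailment

    cut-list : ∀ {A W} X → A ⊢ (W ⁺++ X) → (∀ {x} → x ∈ X → (A ∪ [ x ]) ⊢ W) → A ⊢ W
    cut-list {W = W} [] A⊢W _ = weak⊢ A⊢W ⊆-refl (⊆-reflexive (++-identityʳ (toList W)))
    cut-list {A} {W} (x ∷ X) A⊢W,x,X A,x⊢W =
      cut-list X (cut⊢ (weak⊢ A⊢W,x,X ⊆-refl x-to-end)
                       (weak⊢ (A,x⊢W (here refl)) ⊆-refl (xs⊆xs++ys (toList W) X)))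
                 (A,x⊢W ∘ there)
      where
        x-to-end : toList W ++ x ∷ X ⊆ˡ (toList W ++ X) ++ x ∷ []
        x-to-end = ⊆-reflexive-↭ (↭-trans (shift x (toList W) X) (++-comm (x ∷ []) (toList W ++ X)))

    cut-all₂ : ∀ {A X Y W} → A ⊢ X → A ⊢ Y →
               (∀ {x y} → x ∈ toList X → y ∈ toList Y → ((A ∪ [ x ]) ∪ [ y ]) ⊢ W) → A ⊢ W
    cut-all₂ {A} {X} {Y} {W} A⊢X A⊢Y A,x,y⊢W =
      cut-list (toList X) (weak⊢ A⊢X ⊆-refl (xs⊆ys++xs (toList X) (toList W))) λ {x} x∈X →
        cut-list (toList Y) (weak⊢ A⊢Y (xs⊆xs++ys (toList A) (x ∷ [])) (xs⊆ys++xs (toList Y) (toList W)))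
                 (A,x,y⊢W x∈X)

    transfer-step : ∀ h u v → (u ∷ v ∷ []) ⊢ (u + h ∷ v - h ∷ [])
    transfer-step h u v =
      subst₂ _⊢_ (cong₂ pair (identityˡ u) (x+[y-x]≡y h v)) (cong₂ pair (comm h u) (identityˡ (v - h)))
                 (swap⊢ 0# h u (v - h))
      where
        pair : Carrier → Carrier → Fin⁺
        pair x y = x ∷ y ∷ []

    transferˡ : ∀ {h m u v} → IsSumOf (h ∷ []) m → (u ∷ v ∷ []) ⊢ (u + m ∷ v - h ∷ [])
    transferˡ {u = u} [] =
      weak⊢ (refl⊢ u) (λ { (here refl) → here refl }) (λ { (here refl) → here (sym (identityʳ u)) })
    transferˡ {h} {u = u} {v} (_∷_ {m = m} (here refl) M) =
      cut⊢ {c = u + h}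
        (weak⊢ (transfer-step h u v) ⊆-refl
               λ { (here refl) → there (there (here refl)) ; (there (here refl)) → there (here refl) })
        (weak⊢ (transferˡ {u = u + h} M)
               (λ { (here refl) → there (there (here refl)) ; (there (here refl)) → there (here refl) })
               (λ { (here refl) → here (assoc u h m) ; (there (here refl)) → there (here refl) }))

    transfer : ∀ {h m n u v} → IsSumOf (h ∷ []) m → IsSumOf (- h ∷ []) n →
               (u ∷ v ∷ []) ⊢ (u + m ∷ v + n ∷ [])
    transfer {v = v} M [] =
      weak⊢ (refl⊢ v) (λ { (here refl) → there (here refl) }) (λ { (here refl) → there (here (sym (identityʳ v))) })
    transfer {h} {v = v} M (_∷_ {m = n} (here refl) N) =
      cut⊢ {c = v - h}
        (weak⊢ (transferˡ M) ⊆-refl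
               λ { (here refl) → here refl ; (there (here refl)) → there (there (here refl)) })
        (weak⊢ (transfer {v = v - h} M N)
               (λ { (here refl) → here refl ; (there (here refl)) → there (there (here refl)) })
               (λ { (here refl) → here refl ; (there (here refl)) → there (here (assoc v (- h) n)) }))

    infix 4 _⊢[_]_
    _⊢[_]_ : Fin⁺ → List Carrier → Fin⁺ → Set
    A ⊢[ ws ] B = Σ[ T ∈ List⁺ (Lowered B ws) ] A ⊢ L⁺.map value T

    ⊢ₛ[]⇒⊢[] : ∀ {A B zs} → A ⊢ₛ[ zs ] B → A ⊢[ zs ] B
    ⊢ₛ[]⇒⊢[] (a , b , a∈A , b∈B , m , M , a+m≤b) =
      [ lowered b b∈B m M ] , weak⊢ (ord⊢ (x+y≤z⇒x≤z-y a+m≤b)) (λ { (here refl) → a∈A }) ⊆-refl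

    ⊢[[]]⇒⊢ : ∀ {A B} → A ⊢[ [] ] B → A ⊢ B
    ⊢[[]]⇒⊢ {A} {B} (T , A⊢T) = weak⊢ A⊢T ⊆-refl values∈B
      where
        values∈B : ∀ {x} → x ∈ toList (L⁺.map value T) → x ∈ toList B
        values∈B x∈ with ∈-map⁻ value {xs = toList T} x∈
        ... | lowered b b∈B _ [] , _ , refl = subst (_∈ toList B) (sym (x-0≡x b)) b∈B

    ⊢[]-elim : ∀ {A B} ws h → A ⊢[ ws ++ h ∷ [] ] B → A ⊢[ ws ++ - h ∷ [] ] B → A ⊢[ ws ] B
    ⊢[]-elim {A} {B} ws h (T⁺ , A⊢T⁺) (T⁻ , A⊢T⁻) = T , cut-all₂ A⊢T⁺ A⊢T⁻ transfer-pair
      where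
        restricted : ∀ xs → List⁺ (Lowered B (ws ++ xs)) → List⁺ (Lowered B ws)
        restricted xs = L⁺.map (proj₁ ∘ restrict ws xs)

        T : List⁺ (Lowered B ws)
        T = restricted (h ∷ []) T⁺ ⁺++⁺ restricted (- h ∷ []) T⁻

        value∈T : ∀ {t} → t ∈ toList T → value t ∈ toList (L⁺.map value T)
        value∈T = ∈-map⁺ value

        transfer-pair : ∀ {x y} → x ∈ toList (L⁺.map value T⁺) → y ∈ toList (L⁺.map value T⁻) →
                        ((A ∪ [ x ]) ∪ [ y ]) ⊢ L⁺.map value T
        transfer-pair x∈ y∈ with ∈-map⁻ value {xs = toList T⁺} x∈ | ∈-map⁻ value {xs = toList T⁻} y∈
        ... | t , t∈T⁺ , refl | s , s∈T⁻ , refl =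
          let t′ , m , M , t+m≡t′ = restrict ws (h ∷ []) t
              s′ , n , N , s+n≡s′ = restrict ws (- h ∷ []) s
          in weak⊢ (transfer M N)
               (λ { (here refl) → ∈-++⁺ˡ (∈-++⁺ʳ (toList A) (here refl))
                  ; (there (here refl)) → ∈-++⁺ʳ (toList A ++ value t ∷ []) (here refl) })
               (λ { (here refl) → subst (_∈ toList (L⁺.map value T)) (sym t+m≡t′)
                                    (value∈T (∈-++⁺ˡ (∈-map⁺ (proj₁ ∘ restrict ws (h ∷ [])) t∈T⁺)))
                  ; (there (here refl)) → subst (_∈ toList (L⁺.map value T)) (sym s+n≡s′)
                                    (value∈T (∈-++⁺ʳ (toList (restricted (h ∷ []) T⁺))
                                                     (∈-map⁺ (proj₁ ∘ restrict ws (- h ∷ [])) s∈T⁻))) })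

    ⊢[]-elim-signs : ∀ {A B} ws xs → (∀ zs → Signs G xs zs → A ⊢[ ws ++ zs ] B) → A ⊢[ ws ] B
    ⊢[]-elim-signs {A} {B} ws []       A⊢ = subst (A ⊢[_] B) (++-identityʳ ws) (A⊢ [] [])
    ⊢[]-elim-signs {A} {B} ws (x ∷ xs) A⊢ = ⊢[]-elim ws x (with-sign x pos) (with-sign (- x) neg)
      where
        with-sign : ∀ z → (∀ {zs} → Signs G xs zs → Signs G (x ∷ xs) (z ∷ zs)) → A ⊢[ ws ++ z ∷ [] ] B
        with-sign z sign = ⊢[]-elim-signs (ws ++ z ∷ []) xs λ zs signs →
          subst (A ⊢[_] B) (sym (++-assoc ws (z ∷ []) zs)) (A⊢ (z ∷ zs) (sign signs))

    ⊢ₛ⇒⊢ : ∀ {A B} → A ⊢ₛ B → A ⊢ B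
    ⊢ₛ⇒⊢ (xs , A⊢ₛB) = ⊢[[]]⇒⊢ (⊢[]-elim-signs [] xs λ zs signs → ⊢ₛ[]⇒⊢[] (A⊢ₛB zs signs))

corollary4p12 : (G : OrderedGroup) → IsFinestRegular G (Reg G (_▷ₛ_ G))
corollary4p12 G =
    IsRegularEntailment-resp-⇔ ⊢ₛ⇒Reg Reg⇒⊢ₛ ⊢ₛ-isRegularEntailment
  , λ _ isRegular A⊢B → ⊢ₛ⇒⊢ isRegular (Reg⇒⊢ₛ A⊢B)
  where open Regularisation G
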